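{- A positive integer $n$ is quasi-practical if and only if $n$ is practical or $n$ is prime.
   Context: For $n\in\mathbb{N}$, $\sigma(n)$ is the sum of all positive divisors of $n$ and $s(n)=\sigma(n)-n$ is the sum of all proper positive divisors of $n$ (divisors different from $n$). A positive integer $n$ is practical if every integer $k$ with $1\le k\le\sigma(n)$ is a sum of distinct positive divisors of $n$. A positive integer $n$ is quasi-practical if every positive integer $k\le s(n)$ is a sum of distinct proper positive divisors of $n$. -}

module Defs where

open import Data.Nat using (ℕ; zero; suc; _+_; _∸_; _≤_; _<_)
open import Data.Nat.Divisibility using (_∣_; _∣?_)
open import Data.List using (List; filter; map; upTo)
open import Data.Nat.ListAction using (sum)
open import Data.List.Relation.Unary.All using (All)
open import Data.List.Relation.Unary.Unique.Propositional using (Unique)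
open import Data.Product using (Σ; _×_)
open import Relation.Binary.PropositionalEquality using (_≡_; _≢_)

divisors : ℕ → List ℕ
divisors n = filter (_∣? n) (map suc (upTo n))

σ : ℕ → ℕ
σ n = sum (divisors n)

s : ℕ → ℕ
s n = σ n ∸ n

SumOfDistinctDivisors : ℕ → ℕ → Set
SumOfDistinctDivisors n k =
  Σ (List ℕ) λ ds → Unique ds × All (λ d → 0 < d × d ∣ n) ds × sum ds ≡ k

SumOfDistinctProperDivisors : ℕ → ℕ → Set
SumOfDistinctProperDivisors n k =
  Σ (List ℕ) λ ds → Unique ds × All (λ d → 0 < d × d ∣ n × d ≢ n) ds × sum ds ≡ k

Practical : ℕ → Set
Practical n = (k : ℕ) → 1 ≤ k → k ≤ σ n → SumOfDistinctDivisors n k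

QuasiPractical : ℕ → Set
QuasiPractical n = (k : ℕ) → 1 ≤ k → k ≤ s n → SumOfDistinctProperDivisors n k

-- Write σ≤ n t for the sum of the divisors of n that are at most t.  By the
-- greedy argument, every k ≤ σ≤ n t is a sum of distinct divisors ≤ t exactly
-- when each divisor d ≤ t satisfies d ≤ 1 + σ≤ n (d − 1) (Stewart's criterion
-- below t); practicality of n is the criterion below n, and quasi-practicality
-- the criterion below n − 1, since s n = σ≤ n (n − 1).  So a quasi-practical n
-- fails to be practical only if n − 1 > s n.  A prime satisfies the criterion
-- below n − 1 trivially; a composite n has s n ≥ 2, and writing 2 as a sum of
-- distinct proper divisors forces 2 ∣ n, whereupon the criterion at the divisor
-- n / 2 gives s n ≥ σ≤ n (n / 2) ≥ (n / 2 − 1) + n / 2 = n − 1.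
module Submission where

open import Defs
open import Data.Nat using (ℕ; zero; suc; _+_; _*_; _∸_; _≤_; _<_; z≤n; s≤s; _≤?_; nonTrivial⇒n>1)
open import Data.Nat.Properties
open import Data.Nat.Divisibility using (_∣_; _∣?_; ∣-refl; divides)
open import Data.Nat.Primality
  using (Prime; Composite; composite; prime?; prime⇒¬composite; ¬prime⇒composite)
open import Data.Nat.ListAction using (sum)
open import Data.Nat.ListAction.Properties using (sum-++)
open import Data.List using (List; []; _∷_; [_]; _++_; filter; map; upTo)
open import Data.List.Properties
  using (upTo-∷ʳ; map-++; filter-++; filter-accept; filter-reject; filter-all)
open import Data.List.Relation.Unary.All as All using (All; []; _∷_)
open import Data.List.Relation.Unary.All.Properties using (all-filter; filter⁺)
open import Data.List.Relation.Unary.AllPairs using ([]; _∷_)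
open import Data.List.Relation.Unary.Unique.Propositional using (Unique)
import Data.List.Relation.Unary.Unique.Propositional.Properties as Unique
open import Data.Product using (Σ; _×_; _,_; proj₁)
open import Data.Sum using (_⊎_; inj₁; inj₂)
open import Function.Bundles using (_⇔_; mk⇔)
open import Relation.Nullary using (Dec; yes; no; ¬_; ¬?; contradiction)
open import Relation.Binary.PropositionalEquality
  using (_≡_; _≢_; ≢-sym; refl; sym; trans; cong; cong₂; subst; module ≡-Reasoning)

all≤sum : ∀ ds → All (_≤ sum ds) ds
all≤sum []       = []
all≤sum (d ∷ ds) =
  m≤m+n d (sum ds) ∷ All.map (λ e≤ → ≤-trans e≤ (m≤n+m (sum ds) d)) (all≤sum ds)

_≢?_ : ∀ d x → Dec (d ≢ x)
d ≢? x = ¬? (d ≟ x)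

sum≤sum-filter≢+ : ∀ x {ds} → Unique ds → sum ds ≤ sum (filter (_≢? x) ds) + x
sum≤sum-filter≢+ x {[]}     _            = z≤n
sum≤sum-filter≢+ x {d ∷ ds} (d≢ds ∷ uds) with d ≟ x
... | yes refl = ≤-reflexive (begin
      d + sum ds                         ≡⟨ +-comm d (sum ds) ⟩
      sum ds + d                         ≡⟨ cong (λ l → sum l + d) (sym ds-kept) ⟩
      sum (filter (_≢? d) ds) + d        ≡⟨ cong (λ l → sum l + d) (sym d-dropped) ⟩
      sum (filter (_≢? d) (d ∷ ds)) + d  ∎)
  where
    open ≡-Reasoning
    ds-kept : filter (_≢? d) ds ≡ ds
    ds-kept = filter-all (_≢? d) (All.map ≢-sym d≢ds)
    d-dropped : filter (_≢? d) (d ∷ ds) ≡ filter (_≢? d) ds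
    d-dropped = filter-reject (_≢? d) (λ d≢d → d≢d refl)
... | no d≢x = begin
      d + sum ds                         ≤⟨ +-monoʳ-≤ d (sum≤sum-filter≢+ x uds) ⟩
      d + (sum (filter (_≢? x) ds) + x)  ≡⟨ sym (+-assoc d _ x) ⟩
      sum (d ∷ filter (_≢? x) ds) + x    ≡⟨ cong (λ l → sum l + x) (sym (filter-accept (_≢? x) d≢x)) ⟩
      sum (filter (_≢? x) (d ∷ ds)) + x  ∎
  where open ≤-Reasoning

divisorOrZero : ℕ → ℕ → ℕ
divisorOrZero n d with d ∣? n
... | yes _ = d
... | no  _ = 0

σ≤ : ℕ → ℕ → ℕ
σ≤ n zero    = 0
σ≤ n (suc t) = σ≤ n t + divisorOrZero n (suc t)

DivisorAtMost : ℕ → ℕ → ℕ → Set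
DivisorAtMost n t d = 0 < d × d ∣ n × d ≤ t

SumOfDistinctDivisorsAtMost : ℕ → ℕ → ℕ → Set
SumOfDistinctDivisorsAtMost n t k =
  Σ (List ℕ) λ ds → Unique ds × All (DivisorAtMost n t) ds × sum ds ≡ k

-- Stewart's criterion for the divisors d = 1 + u ≤ t of n: d ≤ 1 + σ≤ n (d − 1).
Stewart : ℕ → ℕ → Set
Stewart n t = ∀ u → u < t → suc u ∣ n → u ≤ σ≤ n u

module _ (n : ℕ) where

  divisorOrZero-∣ : ∀ {d} → d ∣ n → divisorOrZero n d ≡ d
  divisorOrZero-∣ {d} d∣n with d ∣? n
  ... | yes _   = refl
  ... | no  d∤n = contradiction d∣n d∤n

  sum-divisors-upTo : ∀ t → sum (filter (_∣? n) (map suc (upTo t))) ≡ σ≤ n t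
  sum-divisors-upTo zero    = refl
  sum-divisors-upTo (suc t) = begin
      sum (filter (_∣? n) (map suc (upTo (suc t))))
        ≡⟨ cong (λ l → sum (filter (_∣? n) (map suc l))) (sym (upTo-∷ʳ t)) ⟩
      sum (filter (_∣? n) (map suc (upTo t ++ [ t ])))
        ≡⟨ cong (λ l → sum (filter (_∣? n) l)) (map-++ suc (upTo t) [ t ]) ⟩
      sum (filter (_∣? n) (map suc (upTo t) ++ [ suc t ]))
        ≡⟨ cong sum (filter-++ (_∣? n) (map suc (upTo t)) [ suc t ]) ⟩
      sum (filter (_∣? n) (map suc (upTo t)) ++ filter (_∣? n) [ suc t ])
        ≡⟨ sum-++ (filter (_∣? n) (map suc (upTo t))) (filter (_∣? n) [ suc t ]) ⟩
      sum (filter (_∣? n) (map suc (upTo t))) + sum (filter (_∣? n) [ suc t ])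
        ≡⟨ cong₂ _+_ (sum-divisors-upTo t) sum-filter-singleton ⟩
      σ≤ n (suc t) ∎
    where
      open ≡-Reasoning
      sum-filter-singleton : sum (filter (_∣? n) [ suc t ]) ≡ divisorOrZero n (suc t)
      sum-filter-singleton with suc t ∣? n
      ... | yes t+1∣n =
        trans (cong sum (filter-accept (_∣? n) {xs = []} t+1∣n)) (+-identityʳ (suc t))
      ... | no  t+1∤n = cong sum (filter-reject (_∣? n) {xs = []} t+1∤n)

  σ≡σ≤ : σ n ≡ σ≤ n n
  σ≡σ≤ = sum-divisors-upTo n

  σ≤-∣ : ∀ {u} → suc u ∣ n → σ≤ n (suc u) ≡ σ≤ n u + suc u
  σ≤-∣ {u} u+1∣n = cong (σ≤ n u +_) (divisorOrZero-∣ u+1∣n)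

  σ≤-mono : ∀ {a b} → a ≤ b → σ≤ n a ≤ σ≤ n b
  σ≤-mono {b = zero}  z≤n = ≤-refl
  σ≤-mono {b = suc b} a≤b+1 with m≤n⇒m<n∨m≡n a≤b+1
  ... | inj₁ a<b+1 = ≤-trans (σ≤-mono (m<1+n⇒m≤n a<b+1)) (m≤m+n (σ≤ n b) _)
  ... | inj₂ refl  = ≤-refl

  divisor≤σ≤ : ∀ {d t} → d ∣ n → d ≤ t → d ≤ σ≤ n t
  divisor≤σ≤ {zero}        _   _   = z≤n
  divisor≤σ≤ {suc u} {t} d∣n d≤t = begin
    suc u           ≤⟨ m≤n+m (suc u) (σ≤ n u) ⟩
    σ≤ n u + suc u  ≡⟨ sym (σ≤-∣ d∣n) ⟩
    σ≤ n (suc u)    ≤⟨ σ≤-mono d≤t ⟩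
    σ≤ n t          ∎
    where open ≤-Reasoning

  σ≤-< : ∀ {u t} → suc u ∣ n → u < t → σ≤ n u < σ≤ n t
  σ≤-< {u} {t} u+1∣n u<t = begin-strict
    σ≤ n u          <⟨ m<m+n (σ≤ n u) (s≤s z≤n) ⟩
    σ≤ n u + suc u  ≡⟨ sym (σ≤-∣ u+1∣n) ⟩
    σ≤ n (suc u)    ≤⟨ σ≤-mono u<t ⟩
    σ≤ n t          ∎
    where open ≤-Reasoning

  divisorAtMost-lower : ∀ {t d} → DivisorAtMost n (suc t) d → d ≢ suc t → DivisorAtMost n t d
  divisorAtMost-lower (0<d , d∣n , d≤t+1) d≢t+1 = 0<d , d∣n , m<1+n⇒m≤n (≤∧≢⇒< d≤t+1 d≢t+1)

  sum-distinct-divisors≤σ≤ : ∀ t {ds} → Unique ds → All (DivisorAtMost n t) ds → sum ds ≤ σ≤ n t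
  sum-distinct-divisors≤σ≤ zero    {[]}    _ _                     = z≤n
  sum-distinct-divisors≤σ≤ zero    {_ ∷ _} _ ((0<d , _ , d≤0) ∷ _) = contradiction d≤0 (<⇒≱ 0<d)
  sum-distinct-divisors≤σ≤ (suc t) {ds}    uds all≤t+1 with suc t ∣? n
  ... | no t+1∤n = begin
      sum ds      ≤⟨ sum-distinct-divisors≤σ≤ t uds all≤t ⟩
      σ≤ n t      ≡⟨ sym (+-identityʳ (σ≤ n t)) ⟩
      σ≤ n t + 0  ∎
    where
      open ≤-Reasoning
      all≤t : All (DivisorAtMost n t) ds
      all≤t = All.map (λ d@(_ , d∣n , _) → divisorAtMost-lower d λ { refl → t+1∤n d∣n }) all≤t+1
  ... | yes _ = begin
      sum ds                               ≤⟨ sum≤sum-filter≢+ (suc t) uds ⟩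
      sum (filter (_≢? suc t) ds) + suc t  ≤⟨ +-monoˡ-≤ (suc t) (sum-distinct-divisors≤σ≤ t uds' all≤t) ⟩
      σ≤ n t + suc t                       ∎
    where
      open ≤-Reasoning
      uds' : Unique (filter (_≢? suc t) ds)
      uds' = Unique.filter⁺ (_≢? suc t) uds
      all≤t : All (DivisorAtMost n t) (filter (_≢? suc t) ds)
      all≤t = All.zipWith (λ (d , d≢t+1) → divisorAtMost-lower d d≢t+1)
                          (filter⁺ (_≢? suc t) all≤t+1 , all-filter (_≢? suc t) ds)

  -- If σ≤ n u < u, all summands of σ≤ n u + 1 would be at most u, and those sum to at most σ≤ n u.
  stewart-necessary : ∀ u → SumOfDistinctDivisors n (suc (σ≤ n u)) → u ≤ σ≤ n u
  stewart-necessary u (ds , uds , all∣ , sum≡) with u ≤? σ≤ n u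
  ... | yes u≤σ = u≤σ
  ... | no  u≰σ =
    contradiction (subst (_≤ σ≤ n u) sum≡ (sum-distinct-divisors≤σ≤ u uds all≤u)) (<-irrefl refl)
    where
      sum≤u : sum ds ≤ u
      sum≤u = subst (_≤ u) (sym sum≡) (≰⇒> u≰σ)
      all≤u : All (DivisorAtMost n u) ds
      all≤u = All.zipWith (λ ((0<d , d∣n) , d≤sum) → 0<d , d∣n , ≤-trans d≤sum sum≤u) (all∣ , all≤sum ds)

  divisorsAtMost-raise : ∀ {t t' k} → t ≤ t' →
                         SumOfDistinctDivisorsAtMost n t k → SumOfDistinctDivisorsAtMost n t' k
  divisorsAtMost-raise t≤t' (ds , uds , all≤t , sum≡) =
    ds , uds , All.map (λ (0<d , d∣n , d≤t) → 0<d , d∣n , ≤-trans d≤t t≤t') all≤t , sum≡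

  divisorsAtMost-∷ : ∀ {t k} → suc t ∣ n →
                     SumOfDistinctDivisorsAtMost n t k → SumOfDistinctDivisorsAtMost n (suc t) (suc t + k)
  divisorsAtMost-∷ {t} t+1∣n (ds , uds , all≤t , sum≡) =
    suc t ∷ ds ,
    All.map (λ (_ , _ , d≤t) → >⇒≢ (s≤s d≤t)) all≤t ∷ uds ,
    (s≤s z≤n , t+1∣n , ≤-refl) ∷ All.map (λ (0<d , d∣n , d≤t) → 0<d , d∣n , m≤n⇒m≤1+n d≤t) all≤t ,
    cong (suc t +_) sum≡

  stewart-restrict : ∀ {t t'} → t ≤ t' → Stewart n t' → Stewart n t
  stewart-restrict t≤t' st u u<t = st u (<-≤-trans u<t t≤t')

  stewart-extend : ∀ {t} → Stewart n t → (suc t ∣ n → t ≤ σ≤ n t) → Stewart n (suc t)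
  stewart-extend st at-t u u<t+1 with m≤n⇒m<n∨m≡n (m<1+n⇒m≤n u<t+1)
  ... | inj₁ u<t  = st u u<t
  ... | inj₂ refl = at-t

  -- Greedy: if k exceeds σ≤ n t, then t + 1 is a divisor and k − (t + 1) ≤ σ≤ n t.
  stewart-sufficient : ∀ t → Stewart n t → ∀ k → k ≤ σ≤ n t → SumOfDistinctDivisorsAtMost n t k
  stewart-sufficient zero    _  zero _ = [] , [] , [] , refl
  stewart-sufficient (suc t) st k k≤σ with suc t ∣? n | k ≤? σ≤ n t
  ... | _         | yes k≤σt = divisorsAtMost-raise (n≤1+n t) (stewart-sufficient t st' k k≤σt)
    where
      st' : Stewart n t
      st' = stewart-restrict (n≤1+n t) st
  ... | no  _     | no  k≰σt = contradiction (subst (k ≤_) (+-identityʳ (σ≤ n t)) k≤σ) k≰σt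
  ... | yes t+1∣n | no  k≰σt =
    subst (SumOfDistinctDivisorsAtMost n (suc t)) (m+[n∸m]≡n t<k)
          (divisorsAtMost-∷ t+1∣n (stewart-sufficient t st' (k ∸ suc t) rest≤σ))
    where
      st' : Stewart n t
      st' = stewart-restrict (n≤1+n t) st
      t<k : t < k
      t<k = ≤-<-trans (st t ≤-refl t+1∣n) (≰⇒> k≰σt)
      rest≤σ : k ∸ suc t ≤ σ≤ n t
      rest≤σ = m≤n+o⇒m∸n≤o k (suc t) (subst (k ≤_) (+-comm (σ≤ n t) (suc t)) k≤σ)

  stewart-divisor-bound : ∀ {t u} → Stewart n t → u < t → suc u ∣ n → u + suc u ≤ σ≤ n (suc u)
  stewart-divisor-bound {u = u} st u<t u+1∣n =
    subst (u + suc u ≤_) (sym (σ≤-∣ u+1∣n)) (+-monoˡ-≤ (suc u) (st u u<t u+1∣n))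

s≡σ≤ : ∀ m → s (suc m) ≡ σ≤ (suc m) m
s≡σ≤ m = begin
  σ (suc m) ∸ suc m             ≡⟨ cong (_∸ suc m) (trans (σ≡σ≤ (suc m)) (σ≤-∣ (suc m) ∣-refl)) ⟩
  σ≤ (suc m) m + suc m ∸ suc m  ≡⟨ m+n∸n≡m (σ≤ (suc m) m) (suc m) ⟩
  σ≤ (suc m) m                  ∎
  where open ≡-Reasoning

divisorsAtMost⇒divisors : ∀ {n t k} → SumOfDistinctDivisorsAtMost n t k → SumOfDistinctDivisors n k
divisorsAtMost⇒divisors (ds , uds , all≤t , sum≡) =
  ds , uds , All.map (λ (0<d , d∣n , _) → 0<d , d∣n) all≤t , sum≡

divisorsAtMostPred⇒properDivisors : ∀ {m k} →
  SumOfDistinctDivisorsAtMost (suc m) m k → SumOfDistinctProperDivisors (suc m) k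
divisorsAtMostPred⇒properDivisors (ds , uds , all≤m , sum≡) =
  ds , uds , All.map (λ (0<d , d∣n , d≤m) → 0<d , d∣n , λ { refl → <-irrefl refl (s≤s d≤m) }) all≤m , sum≡

properDivisors⇒divisors : ∀ {n k} → SumOfDistinctProperDivisors n k → SumOfDistinctDivisors n k
properDivisors⇒divisors (ds , uds , all∣ , sum≡) =
  ds , uds , All.map (λ (0<d , d∣n , _) → 0<d , d∣n) all∣ , sum≡

practical⇒stewart : ∀ n → Practical n → Stewart n n
practical⇒stewart n practical u u<n u+1∣n =
  stewart-necessary n u (practical (suc (σ≤ n u)) (s≤s z≤n) σ≤u<σ)
  where
    σ≤u<σ : σ≤ n u < σ n
    σ≤u<σ = subst (σ≤ n u <_) (sym (σ≡σ≤ n)) (σ≤-< n u+1∣n u<n)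

stewart⇒practical : ∀ n → Stewart n n → Practical n
stewart⇒practical n st k _ k≤σ =
  divisorsAtMost⇒divisors (stewart-sufficient n n st k (subst (k ≤_) (σ≡σ≤ n) k≤σ))

quasiPractical⇒stewart : ∀ m → QuasiPractical (suc m) → Stewart (suc m) m
quasiPractical⇒stewart m qp u u<m u+1∣n =
  stewart-necessary (suc m) u (properDivisors⇒divisors (qp (suc (σ≤ (suc m) u)) (s≤s z≤n) σ≤u<s))
  where
    σ≤u<s : σ≤ (suc m) u < s (suc m)
    σ≤u<s = subst (σ≤ (suc m) u <_) (sym (s≡σ≤ m)) (σ≤-< (suc m) u+1∣n u<m)

stewart⇒quasiPractical : ∀ m → Stewart (suc m) m → QuasiPractical (suc m)
stewart⇒quasiPractical m st k _ k≤s =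
  divisorsAtMostPred⇒properDivisors (stewart-sufficient (suc m) m st k (subst (k ≤_) (s≡σ≤ m) k≤s))

prime⇒stewart : ∀ m → Prime (suc m) → Stewart (suc m) m
prime⇒stewart m p zero    _   _     = z≤n
prime⇒stewart m p (suc u) u<m u+2∣n = contradiction (composite (s≤s u<m) u+2∣n) (prime⇒¬composite p)

distinct-positives-summing-to-2 : ∀ {ds} → Unique ds → All (0 <_) ds → sum ds ≡ 2 → ds ≡ [ 2 ]
distinct-positives-summing-to-2 {[]}                    _               _            ()
distinct-positives-summing-to-2 {0 ∷ _}                 _               (() ∷ _)     _
distinct-positives-summing-to-2 {1 ∷ []}                _               _            ()
distinct-positives-summing-to-2 {1 ∷ 0 ∷ _}             _               (_ ∷ () ∷ _) _
distinct-positives-summing-to-2 {1 ∷ 1 ∷ _}             ((1≢1 ∷ _) ∷ _) _            _ = contradiction refl 1≢1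
distinct-positives-summing-to-2 {1 ∷ suc (suc _) ∷ _}   _               _            ()
distinct-positives-summing-to-2 {2 ∷ []}                _               _            _ = refl
distinct-positives-summing-to-2 {2 ∷ 0 ∷ _}             _               (_ ∷ () ∷ _) _
distinct-positives-summing-to-2 {2 ∷ suc _ ∷ _}         _               _            ()
distinct-positives-summing-to-2 {suc (suc (suc _)) ∷ _} _               _            ()

quasiPractical⇒2∣ : ∀ {n} → QuasiPractical n → 2 ≤ s n → 2 ∣ n
quasiPractical⇒2∣ qp 2≤s with qp 2 (s≤s z≤n) 2≤s
... | ds , uds , all∣ , sum≡ with distinct-positives-summing-to-2 uds (All.map proj₁ all∣) sum≡
quasiPractical⇒2∣ qp 2≤s | _ , _ , (_ , 2∣n , _) ∷ [] , _ | refl = 2∣n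

composite⇒2≤s : ∀ m → Composite (suc m) → 2 ≤ s (suc m)
composite⇒2≤s m (composite {d} d<n d∣n) =
  subst (2 ≤_) (sym (s≡σ≤ m)) (≤-trans (nonTrivial⇒n>1 d) (divisor≤σ≤ (suc m) d∣n (m<1+n⇒m≤n d<n)))

even∧stewart⇒pred≤s : ∀ m → Stewart (suc m) m → 2 ∣ suc m → m ≤ σ≤ (suc m) m
even∧stewart⇒pred≤s m st (divides zero    ())
even∧stewart⇒pred≤s m st (divides (suc h) n≡2h) = begin
    m                   ≡⟨ m≡h+h+1 ⟩
    h + suc h           ≤⟨ stewart-divisor-bound (suc m) st h<m h+1∣n ⟩
    σ≤ (suc m) (suc h)  ≤⟨ σ≤-mono (suc m) h<m ⟩
    σ≤ (suc m) m        ∎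
  where
    open ≤-Reasoning
    m≡h+h+1 : m ≡ h + suc h
    m≡h+h+1 = begin-equality
      m                 ≡⟨ suc-injective n≡2h ⟩
      suc (h * 2)       ≡⟨ cong suc (*-comm h 2) ⟩
      suc (h + (h + 0)) ≡⟨ cong (λ x → suc (h + x)) (+-identityʳ h) ⟩
      suc (h + h)       ≡⟨ sym (+-suc h h) ⟩
      h + suc h         ∎
    h<m : h < m
    h<m = subst (h <_) (sym m≡h+h+1) (m≤n+m (suc h) h)
    h+1∣n : suc h ∣ suc m
    h+1∣n = divides 2 (trans n≡2h (*-comm (suc h) 2))

quasiPractical∧¬prime⇒pred≤s : ∀ m → QuasiPractical (suc m) → ¬ Prime (suc m) → m ≤ σ≤ (suc m) m
quasiPractical∧¬prime⇒pred≤s zero    _  _  = z≤n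
quasiPractical∧¬prime⇒pred≤s (suc m) qp ¬p =
  even∧stewart⇒pred≤s (suc m) (quasiPractical⇒stewart (suc m) qp)
    (quasiPractical⇒2∣ qp (composite⇒2≤s (suc m) (¬prime⇒composite ¬p)))

theorem2p9 : (n : ℕ) → 0 < n → (QuasiPractical n ⇔ (Practical n ⊎ Prime n))
theorem2p9 (suc m) _ = mk⇔ to from
  where
    to : QuasiPractical (suc m) → Practical (suc m) ⊎ Prime (suc m)
    to qp with prime? (suc m)
    ... | yes p  = inj₂ p
    ... | no  ¬p = inj₁ (stewart⇒practical (suc m) (stewart-extend (suc m) st-below (λ _ → pred≤s)))
      where
        st-below : Stewart (suc m) m
        st-below = quasiPractical⇒stewart m qp
        pred≤s : m ≤ σ≤ (suc m) m
        pred≤s = quasiPractical∧¬prime⇒pred≤s m qp ¬p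

    from : Practical (suc m) ⊎ Prime (suc m) → QuasiPractical (suc m)
    from (inj₁ practical) =
      stewart⇒quasiPractical m (stewart-restrict (suc m) (n≤1+n m) (practical⇒stewart (suc m) practical))
    from (inj₂ p)         = stewart⇒quasiPractical m (prime⇒stewart m p)
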